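{- Let $C$ be a clone on $\{0,1\}$ and let $K$ be a $(C,I_c)$-clonoid. Then: (i) $\overline K$ is a $(C,I_c)$-clonoid; (ii) $K\cup C_0$ is a $(C,I_0)$-clonoid; (iii) $K\cup C_1$ is a $(C,I_1)$-clonoid; (iv) $K\cup C_0\cup C_1$ is a $(C,I)$-clonoid; (v) $K\cup\overline K$ is a $(C,I^*)$-clonoid; (vi) $K\cup\overline K\cup C_0\cup C_1$ is a $(C,\Omega(1))$-clonoid.
   Context: A Boolean function is $f\colon\{0,1\}^n\to\{0,1\}$, $n\ge1$. For sets $F,G$ of Boolean functions, $FG:=\{f(g_1,\dots,g_n): f\in F\ n\text{ -ary},\ g_i\in G\text{ all } m\text{ -ary}\}$. A clone is a set of Boolean functions containing all projections and closed under composition; for clones $C_1,C_2$ a $(C_1,C_2)$-clonoid is a set $K$ of Boolean functions with $KC_1\subseteq K$, $C_2K\subseteq K$. $\overline K=\{\neg\circ f: f\in K\}$. $C_0,C_1$: constant functions (all arities) with value 0, resp. 1. $I_c$: projections; $I_0=I_c\cup C_0$, $I_1=I_c\cup C_1$, $I=I_c\cup C_0\cup C_1$, $I^*=I_c\cup\overline{I_c}$, $\Omega(1)=I^*\cup C_0\cup C_1$. -}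

module Defs where

open import Level using (0ℓ)
open import Data.Nat using (ℕ; suc)
open import Data.Fin using (Fin)
open import Data.Bool using (Bool; true; false; not)
open import Data.Product using (Σ; Σ-syntax; ∃; _×_; _,_)
open import Relation.Unary using (Pred; _⊆_; _∪_)
open import Relation.Binary.PropositionalEquality using (_≡_)

Fun : ℕ → Set
Fun n = (Fin n → Bool) → Bool

-- A Boolean function of arity n ≥ 1, represented as (k , f) with f of arity suc k.
BF : Set
BF = Σ ℕ λ k → Fun (suc k)

BSet : Set₁
BSet = Pred BF 0ℓ

-- FG = { f(g_1,...,g_n) : f ∈ F n-ary, g_i ∈ G all m-ary }, where functions are
-- identified extensionally (h is in FG if it agrees pointwise with such a composite).
data _⊙_ (F G : BSet) : BSet where
  comp : ∀ {n m} (f : Fun (suc n)) (g : Fin (suc n) → Fun (suc m)) →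
         F (n , f) → (∀ i → G (m , g i)) →
         (h : Fun (suc m)) → (∀ x → h x ≡ f (λ i → g i x)) →
         (F ⊙ G) (m , h)

Ic : BSet
Ic (m , h) = Σ (Fin (suc m)) λ i → ∀ x → h x ≡ x i

C₀ : BSet
C₀ (m , h) = ∀ x → h x ≡ false

C₁ : BSet
C₁ (m , h) = ∀ x → h x ≡ true

Neg : BSet → BSet
Neg K (m , h) = Σ (Fun (suc m)) λ f → K (m , f) × (∀ x → h x ≡ not (f x))

I₀ I₁ I Istar Ω1 : BSet
I₀ = Ic ∪ C₀
I₁ = Ic ∪ C₁
I = (Ic ∪ C₀) ∪ C₁
Istar = Ic ∪ Neg Ic
Ω1 = (Istar ∪ C₀) ∪ C₁

IsClone : BSet → Set
IsClone C = (Ic ⊆ C) × ((C ⊙ C) ⊆ C)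

IsClonoid : BSet → BSet → BSet → Set
IsClonoid D₁ D₂ K = ((K ⊙ D₁) ⊆ K) × ((D₂ ⊙ K) ⊆ K)

{-# OPTIONS --safe #-}
module Submission where

open import Defs
open import Data.Product using (_×_; _,_)
open import Relation.Unary using (_∪_; _⊆_)
open import Data.Sum using (inj₁; inj₂)
open import Data.Fin using (zero)
open import Data.Nat using (suc)
open import Data.Bool using (Bool; false; not)
open import Data.Bool.Properties using (not-involutive)
open import Relation.Binary.PropositionalEquality using (_≡_; refl; trans; cong)

-- On the right, K ⊙ C ⊆ K passes to Neg K (negate after composing) and to unions,
-- and constants stay constant under any inner substitution.  On the left, stability
-- under projections is exactly closure under pointwise equality, under constants it is
-- containing the constants, and under negated projections it is closure under negation;
-- K ∪ Neg K is negation-closed because ¬ ¬ f = f.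

-- C₀ and C₁ are definitionally Constant false and Constant true.
Constant : Bool → BSet
Constant b (m , h) = ∀ x → h x ≡ b

Extensional : BSet → Set
Extensional X = ∀ {m} {g h : Fun (suc m)} → X (m , g) → (∀ x → h x ≡ g x) → X (m , h)

NegationClosed : BSet → Set
NegationClosed X = ∀ {m} {g h : Fun (suc m)} → X (m , g) → (∀ x → h x ≡ not (g x)) → X (m , h)

RightClosed : BSet → BSet → Set
RightClosed D X = (X ⊙ D) ⊆ X

LeftClosed : BSet → BSet → Set
LeftClosed D X = (D ⊙ X) ⊆ X

Ic-leftClosed⇒extensional : ∀ {X} → LeftClosed Ic X → Extensional X
Ic-leftClosed⇒extensional Ic⊙X⊆X {g = g} {h} Xg h≗g =
  Ic⊙X⊆X (comp {n = 0} (λ y → y zero) (λ _ → g) (zero , λ _ → refl) (λ _ → Xg) h h≗g)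

extensional⇒Ic-leftClosed : ∀ {X} → Extensional X → LeftClosed Ic X
extensional⇒Ic-leftClosed ext (comp f g (i , f≗πᵢ) Xg h h≗fg) =
  ext (Xg i) (λ x → trans (h≗fg x) (f≗πᵢ _))

∪-extensional : ∀ {A B} → Extensional A → Extensional B → Extensional (A ∪ B)
∪-extensional extA extB (inj₁ a) h≗g = inj₁ (extA a h≗g)
∪-extensional extA extB (inj₂ b) h≗g = inj₂ (extB b h≗g)

Neg-extensional : ∀ {X} → Extensional (Neg X)
Neg-extensional (f , Xf , g≗¬f) h≗g = f , Xf , λ x → trans (h≗g x) (g≗¬f x)

Constant-extensional : ∀ b → Extensional (Constant b)
Constant-extensional b g≗b h≗g x = trans (h≗g x) (g≗b x)

∪-rightClosed : ∀ {D A B} → RightClosed D A → RightClosed D B → RightClosed D (A ∪ B)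
∪-rightClosed rcA rcB (comp f g (inj₁ a) Dg h eq) = inj₁ (rcA (comp f g a Dg h eq))
∪-rightClosed rcA rcB (comp f g (inj₂ b) Dg h eq) = inj₂ (rcB (comp f g b Dg h eq))

Neg-rightClosed : ∀ {D X} → RightClosed D X → RightClosed D (Neg X)
Neg-rightClosed rcX (comp f g (f′ , Xf′ , f≗¬f′) Dg h h≗fg) =
  (λ x → f′ (λ i → g i x)) , rcX (comp f′ g Xf′ Dg _ (λ _ → refl)) ,
  λ x → trans (h≗fg x) (f≗¬f′ _)

Constant-rightClosed : ∀ {D} b → RightClosed D (Constant b)
Constant-rightClosed b (comp f g f≗b Dg h h≗fg) x = trans (h≗fg x) (f≗b _)

∪-leftClosed : ∀ {A B X} → LeftClosed A X → LeftClosed B X → LeftClosed (A ∪ B) X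
∪-leftClosed lcA lcB (comp f g (inj₁ a) Xg h eq) = lcA (comp f g a Xg h eq)
∪-leftClosed lcA lcB (comp f g (inj₂ b) Xg h eq) = lcB (comp f g b Xg h eq)

Constant-leftClosed : ∀ {X} b → Constant b ⊆ X → LeftClosed (Constant b) X
Constant-leftClosed b Cb⊆X (comp f g f≗b Xg h h≗fg) = Cb⊆X (λ x → trans (h≗fg x) (f≗b _))

Neg-Ic-leftClosed : ∀ {X} → NegationClosed X → LeftClosed (Neg Ic) X
Neg-Ic-leftClosed negX (comp f g (f′ , (i , f′≗πᵢ) , f≗¬f′) Xg h h≗fg) =
  negX (Xg i) (λ x → trans (h≗fg x) (trans (f≗¬f′ _) (cong not (f′≗πᵢ _))))

Neg-Constant : ∀ b {m} {g h : Fun (suc m)} →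
  Constant b (m , g) → (∀ x → h x ≡ not (g x)) → Constant (not b) (m , h)
Neg-Constant b g≗b h≗¬g x = trans (h≗¬g x) (cong not (g≗b x))

∪-Neg-negationClosed : ∀ {X} → Extensional X → NegationClosed (X ∪ Neg X)
∪-Neg-negationClosed extX {g = g} (inj₁ Xg) h≗¬g = inj₂ (g , Xg , h≗¬g)
∪-Neg-negationClosed extX (inj₂ (f , Xf , g≗¬f)) h≗¬g =
  inj₁ (extX Xf (λ x → trans (h≗¬g x) (trans (cong not (g≗¬f x)) (not-involutive _))))

∪-constants-negationClosed : ∀ {X} → NegationClosed X → NegationClosed ((X ∪ C₀) ∪ C₁)
∪-constants-negationClosed negX (inj₁ (inj₁ Xg)) h≗¬g = inj₁ (inj₁ (negX Xg h≗¬g))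
∪-constants-negationClosed negX (inj₁ (inj₂ g≗0)) h≗¬g = inj₂ (Neg-Constant false g≗0 h≗¬g)
∪-constants-negationClosed negX (inj₂ g≗1) h≗¬g = inj₁ (inj₂ (Neg-Constant _ g≗1 h≗¬g))

I₀-leftClosed : ∀ {X} → Extensional X → C₀ ⊆ X → LeftClosed I₀ X
I₀-leftClosed extX C₀⊆X =
  ∪-leftClosed (extensional⇒Ic-leftClosed extX) (Constant-leftClosed false C₀⊆X)

I₁-leftClosed : ∀ {X} → Extensional X → C₁ ⊆ X → LeftClosed I₁ X
I₁-leftClosed extX C₁⊆X =
  ∪-leftClosed (extensional⇒Ic-leftClosed extX) (Constant-leftClosed _ C₁⊆X)

I-leftClosed : ∀ {X} → Extensional X → C₀ ⊆ X → C₁ ⊆ X → LeftClosed I X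
I-leftClosed extX C₀⊆X C₁⊆X = ∪-leftClosed (I₀-leftClosed extX C₀⊆X) (Constant-leftClosed _ C₁⊆X)

Istar-leftClosed : ∀ {X} → Extensional X → NegationClosed X → LeftClosed Istar X
Istar-leftClosed extX negX = ∪-leftClosed (extensional⇒Ic-leftClosed extX) (Neg-Ic-leftClosed negX)

Ω1-leftClosed : ∀ {X} → Extensional X → NegationClosed X → C₀ ⊆ X → C₁ ⊆ X → LeftClosed Ω1 X
Ω1-leftClosed extX negX C₀⊆X C₁⊆X =
  ∪-leftClosed (∪-leftClosed (Istar-leftClosed extX negX) (Constant-leftClosed false C₀⊆X))
               (Constant-leftClosed _ C₁⊆X)

∪-constants-extensional : ∀ {X} → Extensional X → Extensional ((X ∪ C₀) ∪ C₁)
∪-constants-extensional extX =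
  ∪-extensional (∪-extensional extX (Constant-extensional false)) (Constant-extensional _)

∪-constants-rightClosed : ∀ {D X} → RightClosed D X → RightClosed D ((X ∪ C₀) ∪ C₁)
∪-constants-rightClosed rcX =
  ∪-rightClosed (∪-rightClosed rcX (Constant-rightClosed false)) (Constant-rightClosed _)

lemma3p2 : (C K : BSet) → IsClone C → IsClonoid C Ic K →
    IsClonoid C Ic (Neg K)
    × IsClonoid C I₀ (K ∪ C₀)
    × IsClonoid C I₁ (K ∪ C₁)
    × IsClonoid C I ((K ∪ C₀) ∪ C₁)
    × IsClonoid C Istar (K ∪ Neg K)
    × IsClonoid C Ω1 (((K ∪ Neg K) ∪ C₀) ∪ C₁)
lemma3p2 C K _ (K⊙C⊆K , Ic⊙K⊆K) =
    (K̄⊙C⊆K̄ , extensional⇒Ic-leftClosed (Neg-extensional {K}))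
  , ( ∪-rightClosed K⊙C⊆K (Constant-rightClosed false)
    , I₀-leftClosed (∪-extensional extK (Constant-extensional false)) inj₂)
  , ( ∪-rightClosed K⊙C⊆K (Constant-rightClosed _)
    , I₁-leftClosed (∪-extensional extK (Constant-extensional _)) inj₂)
  , ( ∪-constants-rightClosed K⊙C⊆K
    , I-leftClosed (∪-constants-extensional extK) (λ c → inj₁ (inj₂ c)) inj₂)
  , (K∪K̄⊙C⊆K∪K̄ , Istar-leftClosed extK∪K̄ negK∪K̄)
  , ( ∪-constants-rightClosed K∪K̄⊙C⊆K∪K̄
    , Ω1-leftClosed (∪-constants-extensional extK∪K̄) (∪-constants-negationClosed negK∪K̄)
                    (λ c → inj₁ (inj₂ c)) inj₂)
  where
  extK : Extensional K
  extK = Ic-leftClosed⇒extensional Ic⊙K⊆K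

  extK∪K̄ : Extensional (K ∪ Neg K)
  extK∪K̄ = ∪-extensional extK (Neg-extensional {K})

  negK∪K̄ : NegationClosed (K ∪ Neg K)
  negK∪K̄ = ∪-Neg-negationClosed extK

  K̄⊙C⊆K̄ : RightClosed C (Neg K)
  K̄⊙C⊆K̄ = Neg-rightClosed K⊙C⊆K

  K∪K̄⊙C⊆K∪K̄ : RightClosed C (K ∪ Neg K)
  K∪K̄⊙C⊆K∪K̄ = ∪-rightClosed K⊙C⊆K K̄⊙C⊆K̄
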